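{- Let $k \geq 2$ and $d \geq 1$ be integers and let $H$ be an $n$-vertex $d$-regular linear $k$-graph. Then the average size of the matchings in $H$ (the expected size of a matching chosen uniformly at random among all matchings of $H$) is at most $\left(1 - \frac{1}{d+1}\right)\frac{n}{k}$.
   Context: A $k$-graph is a $k$-uniform hypergraph; it is linear if any two distinct edges share at most one vertex, and $d$-regular if every vertex lies in exactly $d$ edges. A matching is a set of pairwise vertex-disjoint edges; the empty set counts as a matching. -}

module Defs where

open import Data.Bool using (Bool; true; false; _∧_)
open import Data.Nat using (ℕ; zero; suc; _≡ᵇ_; _≤_)
open import Data.Fin using (Fin)
open import Data.Fin.Subset using (Subset; _∩_; ∣_∣)
open import Data.List using (List; []; _∷_; [_]; map; _++_; length; filterᵇ)
open import Data.Bool.ListAction using (all)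
open import Data.Nat.ListAction using (sum)
import Data.List as L
open import Data.List.Relation.Unary.All using (All)
open import Data.Vec using (lookup)
open import Data.Integer using (+_)
open import Data.Rational using (ℚ; _/_; 0ℚ)
open import Relation.Binary.PropositionalEquality using (_≡_; _≢_)

Hypergraph : ℕ → Set
Hypergraph n = List (Subset n)

Uniform : ∀ {n} → ℕ → Hypergraph n → Set
Uniform k H = All (λ e → ∣ e ∣ ≡ k) H

Linear : ∀ {n} → Hypergraph n → Set
Linear H = ∀ (i j : Fin (length H)) → i ≢ j → ∣ L.lookup H i ∩ L.lookup H j ∣ ≤ 1

degree : ∀ {n} → Fin n → Hypergraph n → ℕ
degree v H = length (filterᵇ (λ e → lookup e v) H)

Regular : ∀ {n} → ℕ → Hypergraph n → Set
Regular d H = ∀ v → degree v H ≡ d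

sublists : ∀ {A : Set} → List A → List (List A)
sublists [] = [ [] ]
sublists (x ∷ xs) = map (x ∷_) (sublists xs) ++ sublists xs

disjointᵇ : ∀ {n} → Subset n → Subset n → Bool
disjointᵇ e f = ∣ e ∩ f ∣ ≡ᵇ 0

pairwiseDisjointᵇ : ∀ {n} → List (Subset n) → Bool
pairwiseDisjointᵇ [] = true
pairwiseDisjointᵇ (e ∷ es) = all (disjointᵇ e) es ∧ pairwiseDisjointᵇ es

-- the list of all matchings of H (each sub-collection of edges occurs once; includes the empty matching)
matchings : ∀ {n} → Hypergraph n → List (List (Subset n))
matchings H = filterᵇ pairwiseDisjointᵇ (sublists H)

-- a / b as a rational number (with the unused convention a / 0 = 0)
frac : ℕ → ℕ → ℚ
frac a zero = 0ℚ
frac a (suc b) = (+ a) / suc b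

averageMatchingSize : ∀ {n} → Hypergraph n → ℚ
averageMatchingSize H = frac (sum (map length (matchings H))) (length (matchings H))

-- Deleting an edge e from a matching containing it leaves a matching that e is disjoint
-- from, so Σ_M |M| is at most the sum over all matchings M of the number of edges disjoint
-- from V(M).  Double counting vertex-edge incidences in a d-regular k-graph on n vertices
-- gives k · #{edges disjoint from C} + d |C| ≤ d n for every vertex set C, and |V(M)| = k |M|.
-- Summing over the N matchings yields (d + 1) k Σ_M |M| ≤ d n N, which is the bound.

module Submission where

open import Defs
open import Algebra using (CommutativeMonoid)
open import Data.Bool using (Bool; true; false; _∧_; T; if_then_else_)
open import Data.Bool.Properties using (∧-assoc; ∧-zeroʳ; ∧-commutativeMonoid; T-∧)
open import Data.Bool.ListAction using (all)
open import Data.Nat using (ℕ; zero; suc; _+_; _*_; _≤_; _≡ᵇ_; z≤n; s≤s)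
open import Data.Nat.Properties
open import Data.Nat.ListAction using (sum)
open import Data.Nat.ListAction.Properties using (sum-++)
open import Data.List using (List; []; _∷_; map; _++_; length; filterᵇ)
open import Data.List.Properties using (map-++; map-∘; map-cong; length-++; filter-++; filter-none)
open import Data.List.Relation.Unary.All as All using (All; []; _∷_)
import Data.List.Relation.Unary.All.Properties as Allₚ
open import Data.Vec using (_∷_; []; lookup; tail)
open import Data.Fin using (zero; suc)
open import Data.Fin.Subset using (Subset; _∩_; _∪_; ∣_∣; ⊥; ⊤; ⋃)
import Data.Fin.Subset.Properties as Subsetₚ
open import Data.Product using (_,_)
open import Data.Integer as ℤ using (+≤+)
open import Data.Integer.Properties using (pos-*)
open import Data.Rational using (1ℚ; toℚᵘ; -_) renaming (_≤_ to _≤ℚ_; _-_ to _-ℚ_; _*_ to _*ℚ_)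
open import Data.Rational.Properties
  using (toℚᵘ-fromℚᵘ; toℚᵘ-cancel-≤; toℚᵘ-injective; toℚᵘ-homo-*; toℚᵘ-homo-+; toℚᵘ-homo‿-)
open import Data.Rational.Unnormalised as ℚᵘ using (mkℚᵘ; _≃_; *≡*; *≤*)
import Data.Rational.Unnormalised.Properties as ℚᵘₚ
open import Function using (_∘_; Equivalence)
open import Relation.Nullary.Decidable using (T?)
open import Relation.Binary.PropositionalEquality

open import Algebra.Properties.CommutativeSemigroup
  (CommutativeMonoid.commutativeSemigroup ∧-commutativeMonoid)
  using () renaming (interchange to ∧-interchange; xy∙z≈xz∙y to ∧-xy∙z≈xz∙y)
open import Algebra.Properties.CommutativeSemigroup +-commutativeSemigroup
  using () renaming (interchange to +-interchange; xy∙z≈y∙xz to +-xy∙z≈y∙xz)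

private variable A B : Set

𝟙 : Bool → ℕ
𝟙 true = 1
𝟙 false = 0

∑ : (A → ℕ) → List A → ℕ
∑ f xs = sum (map f xs)

∑-++ : ∀ (f : A → ℕ) xs ys → ∑ f (xs ++ ys) ≡ ∑ f xs + ∑ f ys
∑-++ f xs ys = trans (cong sum (map-++ f xs ys)) (sum-++ (map f xs) (map f ys))

∑-map : ∀ (f : B → ℕ) (g : A → B) xs → ∑ f (map g xs) ≡ ∑ (f ∘ g) xs
∑-map f g xs = cong sum (sym (map-∘ xs))

∑-cong : ∀ {f g : A → ℕ} → (∀ a → f a ≡ g a) → ∀ xs → ∑ f xs ≡ ∑ g xs
∑-cong f≗g xs = cong sum (map-cong f≗g xs)

∑-+ : ∀ (f g : A → ℕ) xs → ∑ (λ a → f a + g a) xs ≡ ∑ f xs + ∑ g xs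
∑-+ f g [] = refl
∑-+ f g (x ∷ xs) = trans (cong (f x + g x +_) (∑-+ f g xs)) (+-interchange (f x) (g x) _ _)

∑-*ˡ : ∀ c (f : A → ℕ) xs → ∑ (λ a → c * f a) xs ≡ c * ∑ f xs
∑-*ˡ c f [] = sym (*-zeroʳ c)
∑-*ˡ c f (x ∷ xs) = trans (cong (c * f x +_) (∑-*ˡ c f xs)) (sym (*-distribˡ-+ c (f x) _))

∑-const : ∀ c (xs : List A) → ∑ (λ _ → c) xs ≡ length xs * c
∑-const c [] = refl
∑-const c (x ∷ xs) = cong (c +_) (∑-const c xs)

∑-zero : ∀ (xs : List A) → ∑ (λ _ → 0) xs ≡ 0
∑-zero xs = trans (∑-const 0 xs) (*-zeroʳ (length xs))

∑-suc : ∀ (f : A → ℕ) xs → ∑ (suc ∘ f) xs ≡ length xs + ∑ f xs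
∑-suc f xs = trans (∑-+ (λ _ → 1) f xs) (cong (_+ ∑ f xs) (trans (∑-const 1 xs) (*-identityʳ _)))

∑-mono : ∀ {f g : A → ℕ} {xs} → All (λ a → f a ≤ g a) xs → ∑ f xs ≤ ∑ g xs
∑-mono [] = z≤n
∑-mono (fx≤gx ∷ fxs≤gxs) = +-mono-≤ fx≤gx (∑-mono fxs≤gxs)

∑-𝟙 : ∀ (p : A → Bool) xs → ∑ (𝟙 ∘ p) xs ≡ length (filterᵇ p xs)
∑-𝟙 p [] = refl
∑-𝟙 p (x ∷ xs) with p x
... | true = cong suc (∑-𝟙 p xs)
... | false = ∑-𝟙 p xs

filterᵇ-cong : ∀ {p q : A → Bool} → (∀ a → p a ≡ q a) → ∀ xs → filterᵇ p xs ≡ filterᵇ q xs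
filterᵇ-cong {p = p} {q = q} p≗q [] = refl
filterᵇ-cong {p = p} {q = q} p≗q (x ∷ xs) with p x | q x | p≗q x
... | true | true | refl = cong (x ∷_) (filterᵇ-cong p≗q xs)
... | false | false | refl = filterᵇ-cong p≗q xs

filterᵇ-filterᵇ : ∀ (p q : A → Bool) xs → filterᵇ q (filterᵇ p xs) ≡ filterᵇ (λ a → p a ∧ q a) xs
filterᵇ-filterᵇ p q [] = refl
filterᵇ-filterᵇ p q (x ∷ xs) with p x
... | false = filterᵇ-filterᵇ p q xs
... | true with q x
...   | true = cong (x ∷_) (filterᵇ-filterᵇ p q xs)
...   | false = filterᵇ-filterᵇ p q xs

filterᵇ-map : ∀ (p : B → Bool) (f : A → B) xs →
  filterᵇ p (map f xs) ≡ map f (filterᵇ (p ∘ f) xs)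
filterᵇ-map p f [] = refl
filterᵇ-map p f (x ∷ xs) with p (f x)
... | true = cong (f x ∷_) (filterᵇ-map p f xs)
... | false = filterᵇ-map p f xs

filterᵇ-const-∧ : ∀ b (p : A → Bool) xs → filterᵇ (λ a → b ∧ p a) xs ≡ (if b then filterᵇ p xs else [])
filterᵇ-const-∧ true p xs = refl
filterᵇ-const-∧ false p xs = filter-none (T? ∘ λ _ → false) (All.universal (λ _ ()) xs)

filterᵇ-sublists-∷ : ∀ (p : List A → Bool) x xs → filterᵇ p (sublists (x ∷ xs)) ≡
  map (x ∷_) (filterᵇ (p ∘ (x ∷_)) (sublists xs)) ++ filterᵇ p (sublists xs)
filterᵇ-sublists-∷ p x xs = trans (filter-++ (T? ∘ p) (map (x ∷_) (sublists xs)) (sublists xs))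
  (cong (_++ filterᵇ p (sublists xs)) (filterᵇ-map p (x ∷_) (sublists xs)))

All-sublists : ∀ {P : A → Set} {xs : List A} → All P xs → All (All P) (sublists xs)
All-sublists [] = [] ∷ []
All-sublists (px ∷ pxs) = Allₚ.++⁺ (Allₚ.map⁺ (All.map (px ∷_) (All-sublists pxs))) (All-sublists pxs)

∣∷∣ : ∀ {n} b (p : Subset n) → ∣ b ∷ p ∣ ≡ 𝟙 b + ∣ p ∣
∣∷∣ true p = refl
∣∷∣ false p = refl

∣p∪q∣+∣p∩q∣≡∣p∣+∣q∣ : ∀ {n} (p q : Subset n) → ∣ p ∪ q ∣ + ∣ p ∩ q ∣ ≡ ∣ p ∣ + ∣ q ∣
∣p∪q∣+∣p∩q∣≡∣p∣+∣q∣ [] [] = refl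
∣p∪q∣+∣p∩q∣≡∣p∣+∣q∣ (true ∷ p) (true ∷ q) =
  cong suc (trans (+-suc ∣ p ∪ q ∣ _) (trans (cong suc (∣p∪q∣+∣p∩q∣≡∣p∣+∣q∣ p q)) (sym (+-suc ∣ p ∣ _))))
∣p∪q∣+∣p∩q∣≡∣p∣+∣q∣ (true ∷ p) (false ∷ q) = cong suc (∣p∪q∣+∣p∩q∣≡∣p∣+∣q∣ p q)
∣p∪q∣+∣p∩q∣≡∣p∣+∣q∣ (false ∷ p) (true ∷ q) = trans (cong suc (∣p∪q∣+∣p∩q∣≡∣p∣+∣q∣ p q)) (sym (+-suc ∣ p ∣ _))
∣p∪q∣+∣p∩q∣≡∣p∣+∣q∣ (false ∷ p) (false ∷ q) = ∣p∪q∣+∣p∩q∣≡∣p∣+∣q∣ p q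

∣p∪q∣≡0ᵇ : ∀ {n} (p q : Subset n) → (∣ p ∪ q ∣ ≡ᵇ 0) ≡ (∣ p ∣ ≡ᵇ 0) ∧ (∣ q ∣ ≡ᵇ 0)
∣p∪q∣≡0ᵇ [] [] = refl
∣p∪q∣≡0ᵇ (true ∷ p) (b ∷ q) = refl
∣p∪q∣≡0ᵇ (false ∷ p) (true ∷ q) = sym (∧-zeroʳ (∣ p ∣ ≡ᵇ 0))
∣p∪q∣≡0ᵇ (false ∷ p) (false ∷ q) = ∣p∪q∣≡0ᵇ p q

module _ {n : ℕ} where

  disjointᵇ-comm : ∀ (p q : Subset n) → disjointᵇ p q ≡ disjointᵇ q p
  disjointᵇ-comm p q = cong (λ r → ∣ r ∣ ≡ᵇ 0) (Subsetₚ.∩-comm p q)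

  disjointᵇ-⊥ˡ : ∀ (p : Subset n) → disjointᵇ ⊥ p ≡ true
  disjointᵇ-⊥ˡ p rewrite Subsetₚ.∩-zeroˡ p | Subsetₚ.∣⊥∣≡0 n = refl

  disjointᵇ-∪ˡ : ∀ (p q r : Subset n) → disjointᵇ (p ∪ q) r ≡ disjointᵇ p r ∧ disjointᵇ q r
  disjointᵇ-∪ˡ p q r = trans (cong (λ s → ∣ s ∣ ≡ᵇ 0) (Subsetₚ.∩-distribʳ-∪ r p q)) (∣p∪q∣≡0ᵇ (p ∩ r) (q ∩ r))

  disjointᵇ-⋃ˡ : ∀ (M : List (Subset n)) p → disjointᵇ (⋃ M) p ≡ all (disjointᵇ p) M
  disjointᵇ-⋃ˡ [] p = disjointᵇ-⊥ˡ p
  disjointᵇ-⋃ˡ (e ∷ M) p =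
    trans (disjointᵇ-∪ˡ e (⋃ M) p) (cong₂ _∧_ (disjointᵇ-comm e p) (disjointᵇ-⋃ˡ M p))

  all-disjointᵇ-⊥ : ∀ (M : List (Subset n)) → all (disjointᵇ ⊥) M ≡ true
  all-disjointᵇ-⊥ [] = refl
  all-disjointᵇ-⊥ (e ∷ M) rewrite disjointᵇ-⊥ˡ e = all-disjointᵇ-⊥ M

  all-disjointᵇ-∪ : ∀ (p q : Subset n) M → all (disjointᵇ (p ∪ q)) M ≡ all (disjointᵇ p) M ∧ all (disjointᵇ q) M
  all-disjointᵇ-∪ p q [] = refl
  all-disjointᵇ-∪ p q (e ∷ M) =
    trans (cong₂ _∧_ (disjointᵇ-∪ˡ p q e) (all-disjointᵇ-∪ p q M)) (∧-interchange (disjointᵇ p e) _ _ _)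

  ∣p∪q∣-disjoint : ∀ (p q : Subset n) → T (disjointᵇ p q) → ∣ p ∪ q ∣ ≡ ∣ p ∣ + ∣ q ∣
  ∣p∪q∣-disjoint p q p#q = begin
    ∣ p ∪ q ∣             ≡⟨ sym (+-identityʳ _) ⟩
    ∣ p ∪ q ∣ + 0         ≡⟨ cong (∣ p ∪ q ∣ +_) (sym (≡ᵇ⇒≡ ∣ p ∩ q ∣ 0 p#q)) ⟩
    ∣ p ∪ q ∣ + ∣ p ∩ q ∣ ≡⟨ ∣p∪q∣+∣p∩q∣≡∣p∣+∣q∣ p q ⟩
    ∣ p ∣ + ∣ q ∣         ∎
    where open ≡-Reasoning

  𝟙-disjointᵇ*∣q∣+∣p∩q∣≤∣q∣ : ∀ (p q : Subset n) → 𝟙 (disjointᵇ p q) * ∣ q ∣ + ∣ p ∩ q ∣ ≤ ∣ q ∣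
  𝟙-disjointᵇ*∣q∣+∣p∩q∣≤∣q∣ p q with disjointᵇ p q in p#q
  ... | true = ≤-reflexive
    (trans (cong₂ _+_ (+-identityʳ ∣ q ∣) (≡ᵇ⇒≡ ∣ p ∩ q ∣ 0 (subst T (sym p#q) _))) (+-identityʳ ∣ q ∣))
  ... | false = Subsetₚ.∣p∩q∣≤∣q∣ p q

-- Double counting in regular hypergraphs

degree-map-tail : ∀ {m} v (H : Hypergraph (suc m)) → degree v (map tail H) ≡ degree (suc v) H
degree-map-tail v [] = refl
degree-map-tail v ((b ∷ e) ∷ H) with lookup e v
... | true = cong suc (degree-map-tail v H)
... | false = degree-map-tail v H

∣∷p∩q∣ : ∀ {m} b (p : Subset m) q → ∣ (b ∷ p) ∩ q ∣ ≡ 𝟙 (b ∧ lookup q zero) + ∣ p ∩ tail q ∣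
∣∷p∩q∣ b p (c ∷ q) = ∣∷∣ (b ∧ c) (p ∩ q)

∑-∣∩∣-regular : ∀ {n} d (H : Hypergraph n) → Regular d H → ∀ X → ∑ (λ e → ∣ X ∩ e ∣) H ≡ d * ∣ X ∣
∑-∣∩∣-regular {zero} d H regular [] =
  trans (∑-cong (λ { [] → refl }) H) (trans (∑-zero H) (sym (*-zeroʳ d)))
∑-∣∩∣-regular {suc m} d H regular (b ∷ X) = begin
  ∑ (λ e → ∣ (b ∷ X) ∩ e ∣) H
    ≡⟨ trans (∑-cong (∣∷p∩q∣ b X) H) (∑-+ _ _ H) ⟩
  ∑ (λ e → 𝟙 (b ∧ lookup e zero)) H + ∑ (λ e → ∣ X ∩ tail e ∣) H
    ≡⟨ cong₂ _+_ (∑-first b) ∑-rest ⟩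
  d * 𝟙 b + d * ∣ X ∣
    ≡⟨ sym (trans (cong (d *_) (∣∷∣ b X)) (*-distribˡ-+ d _ _)) ⟩
  d * ∣ b ∷ X ∣ ∎
  where
  open ≡-Reasoning
  ∑-first : ∀ b → ∑ (λ e → 𝟙 (b ∧ lookup e zero)) H ≡ d * 𝟙 b
  ∑-first false = trans (∑-zero H) (sym (*-zeroʳ d))
  ∑-first true = trans (∑-𝟙 (λ e → lookup e zero) H) (trans (regular zero) (sym (*-identityʳ d)))
  ∑-rest : ∑ (λ e → ∣ X ∩ tail e ∣) H ≡ d * ∣ X ∣
  ∑-rest = trans (sym (∑-map (λ e → ∣ X ∩ e ∣) tail H))
    (∑-∣∩∣-regular d (map tail H) (λ v → trans (degree-map-tail v H) (regular (suc v))) X)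

∑-size-regular : ∀ {n} d (H : Hypergraph n) → Regular d H → ∑ ∣_∣ H ≡ d * n
∑-size-regular {n} d H regular = begin
  ∑ ∣_∣ H                  ≡⟨ ∑-cong (λ e → cong ∣_∣ (sym (Subsetₚ.∩-identityˡ e))) H ⟩
  ∑ (λ e → ∣ ⊤ ∩ e ∣) H    ≡⟨ ∑-∣∩∣-regular d H regular ⊤ ⟩
  d * ∣ ⊤ {n} ∣            ≡⟨ cong (d *_) (Subsetₚ.∣⊤∣≡n n) ⟩
  d * n                    ∎
  where open ≡-Reasoning

free : ∀ {n} → Subset n → Hypergraph n → ℕ
free C H = ∑ (𝟙 ∘ disjointᵇ C) H

free-bound : ∀ {n} k d (H : Hypergraph n) → Uniform k H → Regular d H →
  ∀ C → k * free C H + d * ∣ C ∣ ≤ d * n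
free-bound {n} k d H uniform regular C = begin
  k * free C H + d * ∣ C ∣
    ≡⟨ cong₂ _+_ (sym (∑-*ˡ k (𝟙 ∘ disjointᵇ C) H)) (sym (∑-∣∩∣-regular d H regular C)) ⟩
  ∑ (λ e → k * 𝟙 (disjointᵇ C e)) H + ∑ (λ e → ∣ C ∩ e ∣) H
    ≡⟨ sym (∑-+ _ _ H) ⟩
  ∑ (λ e → k * 𝟙 (disjointᵇ C e) + ∣ C ∩ e ∣) H
    ≤⟨ ∑-mono (All.map edge-bound uniform) ⟩
  ∑ ∣_∣ H
    ≡⟨ ∑-size-regular d H regular ⟩
  d * n ∎
  where
  open ≤-Reasoning
  edge-bound : ∀ {e} → ∣ e ∣ ≡ k → k * 𝟙 (disjointᵇ C e) + ∣ C ∩ e ∣ ≤ ∣ e ∣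
  edge-bound {e} refl =
    subst (λ m → m + ∣ C ∩ e ∣ ≤ ∣ e ∣) (*-comm _ ∣ e ∣) (𝟙-disjointᵇ*∣q∣+∣p∩q∣≤∣q∣ C e)

-- Matchings

∣⋃∣-matching : ∀ {n} k (M : List (Subset n)) → All (λ e → ∣ e ∣ ≡ k) M → T (pairwiseDisjointᵇ M) →
  ∣ ⋃ M ∣ ≡ k * length M
∣⋃∣-matching {n} k [] [] _ = trans (Subsetₚ.∣⊥∣≡0 n) (sym (*-zeroʳ k))
∣⋃∣-matching k (e ∷ M) (∣e∣≡k ∷ uniform) pairwise with Equivalence.to T-∧ pairwise
... | e#M , pairwise-M = begin
  ∣ e ∪ ⋃ M ∣     ≡⟨ ∣p∪q∣-disjoint e (⋃ M) (subst T e#M≡ e#M) ⟩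
  ∣ e ∣ + ∣ ⋃ M ∣  ≡⟨ cong₂ _+_ ∣e∣≡k (∣⋃∣-matching k M uniform pairwise-M) ⟩
  k + k * length M ≡⟨ sym (*-suc k (length M)) ⟩
  k * length (e ∷ M) ∎
  where
  open ≡-Reasoning
  e#M≡ : all (disjointᵇ e) M ≡ disjointᵇ e (⋃ M)
  e#M≡ = sym (trans (disjointᵇ-comm e (⋃ M)) (disjointᵇ-⋃ˡ M e))

avoidingMatchingᵇ : ∀ {n} → Subset n → List (Subset n) → Bool
avoidingMatchingᵇ B M = all (disjointᵇ B) M ∧ pairwiseDisjointᵇ M

matchingsAvoiding : ∀ {n} → Subset n → Hypergraph n → List (List (Subset n))
matchingsAvoiding B H = filterᵇ (avoidingMatchingᵇ B) (sublists H)

module _ {n : ℕ} where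

  matchings≡matchingsAvoiding-⊥ : ∀ (H : Hypergraph n) → matchings H ≡ matchingsAvoiding ⊥ H
  matchings≡matchingsAvoiding-⊥ H =
    filterᵇ-cong (λ M → sym (cong (_∧ pairwiseDisjointᵇ M) (all-disjointᵇ-⊥ M))) (sublists H)

  avoidingMatchingᵇ-∷ : ∀ (B e : Subset n) M →
    avoidingMatchingᵇ B (e ∷ M) ≡ disjointᵇ B e ∧ avoidingMatchingᵇ (B ∪ e) M
  avoidingMatchingᵇ-∷ B e M = begin
    (disjointᵇ B e ∧ all (disjointᵇ B) M) ∧ (all (disjointᵇ e) M ∧ pairwiseDisjointᵇ M)
      ≡⟨ ∧-assoc (disjointᵇ B e) _ _ ⟩
    disjointᵇ B e ∧ (all (disjointᵇ B) M ∧ (all (disjointᵇ e) M ∧ pairwiseDisjointᵇ M))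
      ≡⟨ cong (disjointᵇ B e ∧_) (sym (∧-assoc (all (disjointᵇ B) M) _ _)) ⟩
    disjointᵇ B e ∧ ((all (disjointᵇ B) M ∧ all (disjointᵇ e) M) ∧ pairwiseDisjointᵇ M)
      ≡⟨ cong (λ b → disjointᵇ B e ∧ (b ∧ pairwiseDisjointᵇ M)) (sym (all-disjointᵇ-∪ B e M)) ⟩
    disjointᵇ B e ∧ avoidingMatchingᵇ (B ∪ e) M ∎
    where open ≡-Reasoning

  matchingsAvoiding-∷ : ∀ (B e : Subset n) H → matchingsAvoiding B (e ∷ H) ≡
    map (e ∷_) (if disjointᵇ B e then matchingsAvoiding (B ∪ e) H else []) ++ matchingsAvoiding B H
  matchingsAvoiding-∷ B e H = trans (filterᵇ-sublists-∷ (avoidingMatchingᵇ B) e H)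
    (cong (λ L → map (e ∷_) L ++ matchingsAvoiding B H)
      (trans (filterᵇ-cong (avoidingMatchingᵇ-∷ B e) (sublists H))
        (filterᵇ-const-∧ (disjointᵇ B e) (avoidingMatchingᵇ (B ∪ e)) (sublists H))))

  ∑-𝟙-disjointᵇ-⋃ : ∀ (B A : Subset n) H →
    ∑ (λ M → 𝟙 (disjointᵇ (⋃ M) A)) (matchingsAvoiding B H) ≡ length (matchingsAvoiding (B ∪ A) H)
  ∑-𝟙-disjointᵇ-⋃ B A H = trans (∑-𝟙 (λ M → disjointᵇ (⋃ M) A) (matchingsAvoiding B H))
    (cong length (trans (filterᵇ-filterᵇ (avoidingMatchingᵇ B) (λ M → disjointᵇ (⋃ M) A) (sublists H))
      (filterᵇ-cong avoiding-A (sublists H))))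
    where
    open ≡-Reasoning
    avoiding-A : ∀ M → avoidingMatchingᵇ B M ∧ disjointᵇ (⋃ M) A ≡ avoidingMatchingᵇ (B ∪ A) M
    avoiding-A M = begin
      (all (disjointᵇ B) M ∧ pairwiseDisjointᵇ M) ∧ disjointᵇ (⋃ M) A
        ≡⟨ cong ((all (disjointᵇ B) M ∧ pairwiseDisjointᵇ M) ∧_) (disjointᵇ-⋃ˡ M A) ⟩
      (all (disjointᵇ B) M ∧ pairwiseDisjointᵇ M) ∧ all (disjointᵇ A) M
        ≡⟨ ∧-xy∙z≈xz∙y (all (disjointᵇ B) M) _ _ ⟩
      (all (disjointᵇ B) M ∧ all (disjointᵇ A) M) ∧ pairwiseDisjointᵇ M
        ≡⟨ cong (_∧ pairwiseDisjointᵇ M) (sym (all-disjointᵇ-∪ B A M)) ⟩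
      avoidingMatchingᵇ (B ∪ A) M ∎

  -- The induction on H has to remember the vertex set B covered by the edges already chosen.
  ∑-length≤∑-free : ∀ (B : Subset n) H →
    ∑ length (matchingsAvoiding B H) ≤ ∑ (λ M → free (B ∪ ⋃ M) H) (matchingsAvoiding B H)
  ∑-length≤∑-free B [] = z≤n
  ∑-length≤∑-free B (e ∷ H) rewrite matchingsAvoiding-∷ B e H with disjointᵇ B e in B#e
  ... | false = ≤-trans (∑-length≤∑-free B H)
    (∑-mono (All.universal (λ M → m≤n+m (free (B ∪ ⋃ M) H) _) (matchingsAvoiding B H)))
  ... | true = begin
    ∑ length (map (e ∷_) L₁ ++ L₂)
      ≡⟨ ∑-++ length (map (e ∷_) L₁) L₂ ⟩
    ∑ length (map (e ∷_) L₁) + ∑ length L₂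
      ≡⟨ cong (_+ ∑ length L₂) (trans (∑-map length (e ∷_) L₁) (∑-suc length L₁)) ⟩
    length L₁ + ∑ length L₁ + ∑ length L₂
      ≤⟨ +-mono-≤ (+-monoʳ-≤ (length L₁) (∑-length≤∑-free (B ∪ e) H)) (∑-length≤∑-free B H) ⟩
    length L₁ + ∑ free₁ L₁ + ∑ free₂ L₂
      ≡⟨ +-xy∙z≈y∙xz (length L₁) _ _ ⟩
    ∑ free₁ L₁ + (length L₁ + ∑ free₂ L₂)
      ≤⟨ +-mono-≤ (∑-mono (All.universal free₁-≤ L₁)) (≤-reflexive (sym ∑-free-∷)) ⟩
    ∑ (λ M → free (B ∪ ⋃ (e ∷ M)) (e ∷ H)) L₁ + ∑ (λ M → free (B ∪ ⋃ M) (e ∷ H)) L₂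
      ≡⟨ sym (trans (∑-++ _ (map (e ∷_) L₁) L₂)
               (cong (_+ ∑ (λ M → free (B ∪ ⋃ M) (e ∷ H)) L₂) (∑-map _ (e ∷_) L₁))) ⟩
    ∑ (λ M → free (B ∪ ⋃ M) (e ∷ H)) (map (e ∷_) L₁ ++ L₂) ∎
    where
    open ≤-Reasoning
    L₁ L₂ : List (List (Subset n))
    L₁ = matchingsAvoiding (B ∪ e) H
    L₂ = matchingsAvoiding B H
    free₁ free₂ : List (Subset n) → ℕ
    free₁ M = free ((B ∪ e) ∪ ⋃ M) H
    free₂ M = free (B ∪ ⋃ M) H
    free₁-≤ : ∀ M → free₁ M ≤ free (B ∪ ⋃ (e ∷ M)) (e ∷ H)
    free₁-≤ M = subst (λ C → free₁ M ≤ free C (e ∷ H)) (Subsetₚ.∪-assoc B e (⋃ M)) (m≤n+m _ _)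
    𝟙-disjointᵇ-e : ∀ M → 𝟙 (disjointᵇ (B ∪ ⋃ M) e) ≡ 𝟙 (disjointᵇ (⋃ M) e)
    𝟙-disjointᵇ-e M = cong 𝟙 (trans (disjointᵇ-∪ˡ B (⋃ M) e) (cong (_∧ disjointᵇ (⋃ M) e) B#e))
    ∑-free-∷ : ∑ (λ M → free (B ∪ ⋃ M) (e ∷ H)) L₂ ≡ length L₁ + ∑ free₂ L₂
    ∑-free-∷ = trans (∑-+ (λ M → 𝟙 (disjointᵇ (B ∪ ⋃ M) e)) free₂ L₂)
      (cong (_+ ∑ free₂ L₂) (trans (∑-cong 𝟙-disjointᵇ-e L₂) (∑-𝟙-disjointᵇ-⋃ B e H)))

∑-length≤∑-free-⋃ : ∀ {n} (H : Hypergraph n) →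
  ∑ length (matchings H) ≤ ∑ (λ M → free (⋃ M) H) (matchings H)
∑-length≤∑-free-⋃ H rewrite matchings≡matchingsAvoiding-⊥ H = ≤-trans (∑-length≤∑-free ⊥ H)
  (≤-reflexive (∑-cong (λ M → cong (λ C → free C H) (Subsetₚ.∪-identityˡ (⋃ M))) (matchingsAvoiding ⊥ H)))

matchings-∣⋃∣ : ∀ {n} k (H : Hypergraph n) → Uniform k H →
  All (λ M → ∣ ⋃ M ∣ ≡ k * length M) (matchings H)
matchings-∣⋃∣ k H uniform = All.zipWith (λ {M} (uniform-M , pairwise) → ∣⋃∣-matching k M uniform-M pairwise)
  ( Allₚ.filter⁺ (T? ∘ pairwiseDisjointᵇ) (All-sublists uniform)
  , Allₚ.all-filter (T? ∘ pairwiseDisjointᵇ) (sublists H))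

matchings-nonempty : ∀ {n} (H : Hypergraph n) → 1 ≤ length (matchings H)
matchings-nonempty [] = s≤s z≤n
matchings-nonempty (e ∷ H)
  rewrite filter-++ (T? ∘ pairwiseDisjointᵇ) (map (e ∷_) (sublists H)) (sublists H)
        | length-++ (filterᵇ pairwiseDisjointᵇ (map (e ∷_) (sublists H))) {matchings H}
  = ≤-trans (matchings-nonempty H) (m≤n+m _ _)

∑-length-matchings-bound : ∀ {n} k d (H : Hypergraph n) → Uniform k H → Regular d H →
  suc d * k * ∑ length (matchings H) ≤ d * n * length (matchings H)
∑-length-matchings-bound {n} k d H uniform regular = begin
  suc d * k * ∑ length L
    ≡⟨ *-assoc (suc d) k (∑ length L) ⟩
  k * ∑ length L + d * (k * ∑ length L)
    ≤⟨ +-monoˡ-≤ _ (*-monoʳ-≤ k (∑-length≤∑-free-⋃ H)) ⟩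
  k * ∑ (λ M → free (⋃ M) H) L + d * (k * ∑ length L)
    ≡⟨ sym (cong₂ _+_ (∑-*ˡ k _ L) (trans (∑-*ˡ d _ L) (cong (d *_) (∑-*ˡ k length L)))) ⟩
  ∑ (λ M → k * free (⋃ M) H) L + ∑ (λ M → d * (k * length M)) L
    ≡⟨ sym (∑-+ _ _ L) ⟩
  ∑ (λ M → k * free (⋃ M) H + d * (k * length M)) L
    ≤⟨ ∑-mono (All.map (λ {M} → matching-bound {M}) (matchings-∣⋃∣ k H uniform)) ⟩
  ∑ (λ _ → d * n) L
    ≡⟨ trans (∑-const (d * n) L) (*-comm (length L) (d * n)) ⟩
  d * n * length L ∎
  where
  open ≤-Reasoning
  L : List (List (Subset n))
  L = matchings H
  matching-bound : ∀ {M} → ∣ ⋃ M ∣ ≡ k * length M → k * free (⋃ M) H + d * (k * length M) ≤ d * n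
  matching-bound {M} ∣⋃M∣≡k∣M∣ =
    subst (λ c → k * free (⋃ M) H + d * c ≤ d * n) ∣⋃M∣≡k∣M∣ (free-bound k d H uniform regular (⋃ M))

toℚᵘ-frac : ∀ a b → toℚᵘ (frac a (suc b)) ≃ mkℚᵘ (ℤ.+ a) b
toℚᵘ-frac a b = toℚᵘ-fromℚᵘ (mkℚᵘ (ℤ.+ a) b)

frac-mono : ∀ a b c d → a * suc d ≤ c * suc b → frac a (suc b) ≤ℚ frac c (suc d)
frac-mono a b c d ad≤cb = toℚᵘ-cancel-≤
  (ℚᵘₚ.≤-respˡ-≃ (ℚᵘₚ.≃-sym (toℚᵘ-frac a b)) (ℚᵘₚ.≤-respʳ-≃ (ℚᵘₚ.≃-sym (toℚᵘ-frac c d))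
    (*≤* (subst₂ ℤ._≤_ (pos-* a (suc d)) (pos-* c (suc b)) (+≤+ ad≤cb)))))

1-frac*frac : ∀ d n k → (1ℚ -ℚ frac 1 (suc d)) *ℚ frac n (suc k) ≡ frac (d * n) (suc d * suc k)
1-frac*frac d n k = toℚᵘ-injective (begin
  toℚᵘ ((1ℚ -ℚ frac 1 (suc d)) *ℚ frac n (suc k))
    ≈⟨ toℚᵘ-homo-* (1ℚ -ℚ frac 1 (suc d)) (frac n (suc k)) ⟩
  toℚᵘ (1ℚ -ℚ frac 1 (suc d)) ℚᵘ.* toℚᵘ (frac n (suc k))
    ≈⟨ ℚᵘₚ.*-cong toℚᵘ-1-frac (toℚᵘ-frac n k) ⟩
  product
    ≈⟨ *≡* (cong₂ ℤ._*_ ↥product (sym ↧product)) ⟩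
  mkℚᵘ (ℤ.+ (d * n)) (k + d * suc k)
    ≈⟨ ℚᵘₚ.≃-sym (toℚᵘ-frac (d * n) (k + d * suc k)) ⟩
  toℚᵘ (frac (d * n) (suc d * suc k)) ∎)
  where
  open ℚᵘₚ.≃-Reasoning
  toℚᵘ-1-frac : toℚᵘ (1ℚ -ℚ frac 1 (suc d)) ≃ toℚᵘ 1ℚ ℚᵘ.- mkℚᵘ (ℤ.+ 1) d
  toℚᵘ-1-frac = ℚᵘₚ.≃-trans (toℚᵘ-homo-+ 1ℚ (- frac 1 (suc d)))
    (ℚᵘₚ.+-congʳ (toℚᵘ 1ℚ) (ℚᵘₚ.≃-trans (toℚᵘ-homo‿- (frac 1 (suc d))) (ℚᵘₚ.-‿cong (toℚᵘ-frac 1 d))))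
  -- toℚᵘ 1ℚ has denominator 1, which leaves the d + 0 below.
  product : ℚᵘ.ℚᵘ
  product = (toℚᵘ 1ℚ ℚᵘ.- mkℚᵘ (ℤ.+ 1) d) ℚᵘ.* mkℚᵘ (ℤ.+ n) k
  ↥product : ℚᵘ.↥ product ≡ ℤ.+ (d * n)
  ↥product = trans (sym (pos-* (d + 0) n)) (cong (λ m → ℤ.+ (m * n)) (+-identityʳ d))
  ↧product : ℚᵘ.↧ product ≡ ℤ.+ (suc d * suc k)
  ↧product = cong (λ m → ℤ.+ (suc m * suc k)) (+-identityʳ d)

corollary5p1 : (k d n : ℕ) → 2 ≤ k → 1 ≤ d → (H : Hypergraph n) →
    Uniform k H → Linear H → Regular d H →
    averageMatchingSize H ≤ℚ ((1ℚ -ℚ frac 1 (d + 1)) *ℚ frac n k)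
corollary5p1 (suc k) d n (s≤s _) _ H uniform _ regular
  with length (matchings H) | matchings-nonempty H | ∑-length-matchings-bound (suc k) d H uniform regular
... | suc N | s≤s _ | bound rewrite +-comm d 1 | 1-frac*frac d n k =
  frac-mono (∑ length (matchings H)) N (d * n) (k + d * suc k)
    (subst (_≤ d * n * suc N) (*-comm (suc d * suc k) _) bound)
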